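{- Let $\mathcal{A}$ be an infinite set, $T$ a finite non-empty set, $\mathcal{G}$ and $\varphi:\mathcal{P}(\mathcal{G})\to\mathcal{P}(\mathcal{G})$ as defined below, and let $\mathcal{E}_0=\varphi(\emptyset)$, $\mathcal{E}_{d+1}=\varphi(\mathcal{E}_d)$ for $d\in\mathbb{N}$, and $\mathcal{E}_\infty=\bigcup_{d\in\mathbb{N}}\mathcal{E}_d$. Then $\mathcal{E}_\infty$ is the smallest fixed point of $\varphi$: $\varphi(\mathcal{E}_\infty)=\mathcal{E}_\infty$, and if $\mathcal{F}\subseteq\mathcal{G}$ satisfies $\varphi(\mathcal{F})=\mathcal{F}$, then $\mathcal{E}_\infty\subseteq\mathcal{F}$.
   Context: For a directed graph $G$, $N(G)$ denotes its node set and $E(G)\subseteq N(G)\times N(G)$ its edge set. A typed temporal graph (over $\mathcal{A}$ with type set $T$) is a triple $(G,t,\tau)$ where $G$ is a directed graph with $N(G)\subseteq\mathcal{A}$, $t:N(G)\to\mathbb{R}$ and $\tau:N(G)\to T$ (no rootedness or compatibility assumed). Write $(G,t,\tau)\sqsubseteq(G',t',\tau')$ iff $N(G)\subseteq N(G')$, $E(G)\subseteq E(G')$, $t'|_{N(G)}=t$ and $\tau'|_{N(G)}=\tau$. $\mathcal{G}$ is the set of all finite sequences $(G_k)_{k=0}^n$ ($n\ge 0$) of typed temporal graphs, and $\mathcal{P}(\mathcal{G})$ its power set. Direct emission: $(G,t,\tau)\sqsubseteq(G',t',\tau')$ by direct emissions iff $(G,t,\tau)\sqsubseteq(G',t',\tau')$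 and there exist a finite non-empty $A\subset\mathcal{A}$ with $A\cap N(G)=\emptyset$ and $p\in N(G)$ such that $N(G')=N(G)\cup A$, $E(G')=E(G)\cup\{(p,a):a\in A\}$, and $t(p)<t'(a)$ for all $a\in A$. Invocation: for $\mathcal{E}\subseteq\mathcal{G}$, $(G,t,\tau)\sqsubseteq(G',t',\tau')$ by $\mathcal{E}$-invocation iff there exist $p\in N(G)$, a sequence $(H_i,t_i,\tau_i)_{i=0}^m\in\mathcal{E}$ whose node sets are disjoint from $N(G)$, and a node $q_m\in N(H_m)$ of in-degree zero in $H_m$, such that $N(G')=N(G)\cup N(H_m)$, $E(G')=E(G)\cup E(H_m)\cup\{(p,q_m)\}$, $t'=t\sqcup t_m$, $\tau'=\tau\sqcup\tau_m$, and $t(p)<t_m(q_m)$ (here $f\sqcup g$ is the map on the union of disjoint domains restricting to $f$ and $g$). A directed graph is $\mathcal{A}$-trivial iff its node set is $\{r\}$ for some $r\in\mathcal{A}$ and it has no edges. For $\mathcal{E}\subseteq\mathcal{G}$, $\varphi(\mathcal{E})$ is the set of all $(G_k)_{k=0}^n\in\mathcal{G}$ such that $G_0$ is $\mathcal{A}$-trivial and for each $0\le k<n$, $G_k\sqsubseteq G_{k+1}$ either by direct emissions or by $\mathcal{E}$-invocation. -}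

module Defs where

import Level
open import Level using (Lift)
open import Data.Nat using (ℕ; zero; suc)
open import Data.Fin using (Fin; inject₁; fromℕ) renaming (zero to fzero; suc to fsuc)
open import Data.List using (List; [])
open import Data.List.Membership.Propositional using (_∈_)
open import Data.Product using (Σ; _×_; ∃)
open import Data.Sum using (_⊎_)
open import Data.Empty using (⊥)
open import Relation.Nullary using (¬_)
open import Relation.Binary.PropositionalEquality using (_≡_)
open import Function.Bundles using (_⇔_)

IsFinite : Set → Set
IsFinite X = Σ (List X) λ xs → ∀ x → x ∈ xs

IsInfinite : Set → Set
IsInfinite X = ¬ IsFinite X

-- Definitions parameterised by the node universe 𝒜, the type set T,
-- the time domain R (the paper's ℝ) and its strict order _<_.
module Graphs (𝒜 T R : Set) (_<_ : R → R → Set) where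

  -- The node set N(G) ⊆ 𝒜 is a predicate,
  -- edges a relation contained in N(G) × N(G); t and τ are given as total
  -- functions on 𝒜 whose values only matter on N(G).
  record TTG : Set₁ where
    field
      Node   : 𝒜 → Set
      Edge   : 𝒜 → 𝒜 → Set
      edgeOk : ∀ {a b} → Edge a b → Node a × Node b
      time   : 𝒜 → R
      type   : 𝒜 → T
  open TTG public

  _⊑_ : TTG → TTG → Set
  G ⊑ G' =
      (∀ a → Node G a → Node G' a)
    × (∀ a b → Edge G a b → Edge G' a b)
    × (∀ a → Node G a → time G' a ≡ time G a)
    × (∀ a → Node G a → type G' a ≡ type G a)

  -- 𝒢 : finite non-empty sequences (G_k)_{k=0}^n, n ≥ 0.
  record Seq : Set₁ where
    field
      len : ℕ
      gr  : Fin (suc len) → TTG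
  open Seq public

  lastG : Seq → TTG
  lastG s = gr s (fromℕ (len s))

  Fam : Set₂
  Fam = Seq → Set₁

  ∅ : Fam
  ∅ _ = Lift (Level.suc Level.zero) ⊥

  _⊆_ : Fam → Fam → Set₁
  E ⊆ F = ∀ s → E s → F s

  _≐_ : Fam → Fam → Set₁
  E ≐ F = (E ⊆ F) × (F ⊆ E)

  -- Direct emission; the finite non-empty set A is given by a non-empty list.
  DirectEmission : TTG → TTG → Set
  DirectEmission G G' =
    G ⊑ G' ×
    Σ (List 𝒜) λ As →
      ¬ (As ≡ []) ×
      (∀ a → a ∈ As → ¬ Node G a) ×
      Σ 𝒜 λ p →
        Node G p ×
        (∀ a → Node G' a ⇔ (Node G a ⊎ a ∈ As)) ×
        (∀ a b → Edge G' a b ⇔ (Edge G a b ⊎ (a ≡ p × b ∈ As))) ×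
        (∀ a → a ∈ As → time G p < time G' a)

  Invocation : Fam → TTG → TTG → Set₁
  Invocation E G G' =
    G ⊑ G' ×
    Σ 𝒜 λ p → Node G p ×
    Σ Seq λ s → E s ×
      (∀ (i : Fin (suc (len s))) a → Node (gr s i) a → ¬ Node G a) ×
      Σ 𝒜 λ q →
        Node (lastG s) q ×
        (∀ a → ¬ Edge (lastG s) a q) ×
        (∀ a → Node G' a ⇔ (Node G a ⊎ Node (lastG s) a)) ×
        (∀ a b → Edge G' a b ⇔ (Edge G a b ⊎ (Edge (lastG s) a b ⊎ (a ≡ p × b ≡ q)))) ×
        (∀ a → Node G a → time G' a ≡ time G a) ×
        (∀ a → Node (lastG s) a → time G' a ≡ time (lastG s) a) ×
        (∀ a → Node G a → type G' a ≡ type G a) ×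
        (∀ a → Node (lastG s) a → type G' a ≡ type (lastG s) a) ×
        (time G p < time (lastG s) q)

  Trivial : TTG → Set
  Trivial G = Σ 𝒜 λ r → (∀ a → Node G a ⇔ (a ≡ r)) × (∀ a b → ¬ Edge G a b)

  Step : Fam → TTG → TTG → Set₁
  Step E G G' = Lift (Level.suc Level.zero) (DirectEmission G G') ⊎ Invocation E G G'

  φ : Fam → Fam
  φ E s = Lift (Level.suc Level.zero) (Trivial (gr s fzero))
        × (∀ (k : Fin (len s)) → Step E (gr s (inject₁ k)) (gr s (fsuc k)))

  𝓔 : ℕ → Fam
  𝓔 zero    = φ ∅
  𝓔 (suc d) = φ (𝓔 d)

  𝓔∞ : Fam
  𝓔∞ s = Σ ℕ λ d → 𝓔 d s

{-# OPTIONS --safe #-}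
module Submission where

-- φ is monotone, and it is finitary: a sequence in φ 𝓔∞ has finitely many
-- steps, each invoking a single member of 𝓔∞ and hence of some 𝓔 d, so the
-- whole sequence already lies in φ (𝓔 D) = 𝓔 (suc D) for the largest such d.
-- Kleene's argument then makes 𝓔∞ = ⋃ φ^(d+1) ∅ the least (pre)fixed point.

open import Defs
open import Data.Product using (_×_; _,_; ∃-syntax)
open import Data.Nat using (ℕ; zero; suc; _≤_; z≤n; s≤s; _⊔_)
open import Data.Nat.Properties using (m≤m⊔n; m≤n⊔m; n≤1+n)
open import Data.Fin using (Fin; inject₁) renaming (zero to fzero; suc to fsuc)
open import Data.Sum using (inj₁; inj₂)
open import Level using (Level; lift)

uniform-bound : ∀ {ℓ : Level} n (P : ℕ → Fin n → Set ℓ) →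
                (∀ {d d'} k → d ≤ d' → P d k → P d' k) →
                (∀ k → ∃[ d ] P d k) → ∃[ D ] (∀ k → P D k)
uniform-bound zero    P mono bounds = 0 , λ ()
uniform-bound (suc n) P mono bounds
  with bounds fzero
     | uniform-bound n (λ d k → P d (fsuc k)) (λ k → mono (fsuc k)) (λ k → bounds (fsuc k))
... | d₀ , p₀ | D , ps = d₀ ⊔ D , λ where
  fzero    → mono fzero (m≤m⊔n d₀ D) p₀
  (fsuc k) → mono (fsuc k) (m≤n⊔m d₀ D) (ps k)

module LeastFixedPoint (𝒜 T R : Set) (_<_ : R → R → Set) where
  open Graphs 𝒜 T R _<_

  ∅-⊆ : ∀ {F} → ∅ ⊆ F
  ∅-⊆ s (lift ())

  Step-mono : ∀ {E F} → E ⊆ F → ∀ {G G'} → Step E G G' → Step F G G'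
  Step-mono E⊆F (inj₁ emission) = inj₁ emission
  Step-mono E⊆F (inj₂ (G⊑G' , p , p∈G , s , s∈E , rest)) =
    inj₂ (G⊑G' , p , p∈G , s , E⊆F s s∈E , rest)

  φ-mono : ∀ {E F} → E ⊆ F → φ E ⊆ φ F
  φ-mono E⊆F s (trivial , steps) =
    trivial , λ k → Step-mono E⊆F {gr s (inject₁ k)} {gr s (fsuc k)} (steps k)

  𝓔-mono : ∀ {d d'} → d ≤ d' → 𝓔 d ⊆ 𝓔 d'
  𝓔-mono {d' = zero}  z≤n       s s∈𝓔 = s∈𝓔
  𝓔-mono {d' = suc _} z≤n       = φ-mono ∅-⊆
  𝓔-mono              (s≤s d≤d') = φ-mono (𝓔-mono d≤d')

  𝓔-⊆-𝓔∞ : ∀ d → 𝓔 d ⊆ 𝓔∞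
  𝓔-⊆-𝓔∞ d s s∈𝓔 = d , s∈𝓔

  Step-𝓔∞-bounded : ∀ {G G'} → Step 𝓔∞ G G' → ∃[ d ] Step (𝓔 d) G G'
  Step-𝓔∞-bounded (inj₁ emission) = 0 , inj₁ emission
  Step-𝓔∞-bounded (inj₂ (G⊑G' , p , p∈G , s , (d , s∈𝓔) , rest)) =
    d , inj₂ (G⊑G' , p , p∈G , s , s∈𝓔 , rest)

  φ-𝓔∞-⊆-𝓔∞ : φ 𝓔∞ ⊆ 𝓔∞
  φ-𝓔∞-⊆-𝓔∞ s (trivial , steps) with uniform-bound (len s) StepAt StepAt-mono bounded
    where
    StepAt : ℕ → Fin (len s) → Set₁
    StepAt d k = Step (𝓔 d) (gr s (inject₁ k)) (gr s (fsuc k))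
    StepAt-mono : ∀ {d d'} k → d ≤ d' → StepAt d k → StepAt d' k
    StepAt-mono k d≤d' = Step-mono (𝓔-mono d≤d') {gr s (inject₁ k)} {gr s (fsuc k)}
    bounded : ∀ k → ∃[ d ] StepAt d k
    bounded k = Step-𝓔∞-bounded {gr s (inject₁ k)} {gr s (fsuc k)} (steps k)
  ... | D , steps-𝓔D = suc D , trivial , steps-𝓔D

  𝓔∞-⊆-φ-𝓔∞ : 𝓔∞ ⊆ φ 𝓔∞
  𝓔∞-⊆-φ-𝓔∞ s (d , s∈𝓔) = φ-mono (𝓔-⊆-𝓔∞ d) s (𝓔-mono (n≤1+n d) s s∈𝓔)

  𝓔∞-fixed : φ 𝓔∞ ≐ 𝓔∞
  𝓔∞-fixed = φ-𝓔∞-⊆-𝓔∞ , 𝓔∞-⊆-φ-𝓔∞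

  𝓔∞-least-prefixed : ∀ F → φ F ⊆ F → 𝓔∞ ⊆ F
  𝓔∞-least-prefixed F φF⊆F s (d , s∈𝓔) = 𝓔-⊆ d s s∈𝓔
    where
    𝓔-⊆ : ∀ d → 𝓔 d ⊆ F
    𝓔-⊆ zero    s s∈𝓔 = φF⊆F s (φ-mono ∅-⊆ s s∈𝓔)
    𝓔-⊆ (suc d) s s∈𝓔 = φF⊆F s (φ-mono (𝓔-⊆ d) s s∈𝓔)

mainTheorem3 : (𝒜 T R : Set) (_<_ : R → R → Set) →
    IsInfinite 𝒜 → IsFinite T → T →
    (Graphs._≐_ 𝒜 T R _<_ (Graphs.φ 𝒜 T R _<_ (Graphs.𝓔∞ 𝒜 T R _<_)) (Graphs.𝓔∞ 𝒜 T R _<_))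
    × (∀ (F : Graphs.Fam 𝒜 T R _<_) →
         Graphs._≐_ 𝒜 T R _<_ (Graphs.φ 𝒜 T R _<_ F) F →
         Graphs._⊆_ 𝒜 T R _<_ (Graphs.𝓔∞ 𝒜 T R _<_) F)
mainTheorem3 𝒜 T R _<_ _ _ _ =
  𝓔∞-fixed , λ F (φF⊆F , _) → 𝓔∞-least-prefixed F φF⊆F
  where open LeastFixedPoint 𝒜 T R _<_
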